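{- For all $n\in\mathbb{N}$ and all $\mathbf{x}\in\{0,1\}^n\setminus\{\mathbf{e}^n\}$, there is exactly one $k\in[n]$ such that either $\partial_kF_n(\mathbf{x})>0$ and $x_k=0$, or $\partial_kF_n(\mathbf{x})<0$ and $x_k=1$.
   Context: For $n\in\mathbb{N}$ and $\mathbf{x}=(x_1,\dots,x_n)^\top\in\mathbb{R}^n$, set $x_0:=1$, $\alpha_{n,n+1}(\mathbf{x})=0$, and for $i\in[n]=\{1,\dots,n\}$: $\alpha_{n,i}(\mathbf{x})=x_i+(1-2x_i)\alpha_{n,i+1}(\mathbf{x})$ and $\beta_{n,i}(\mathbf{x})=2^i(x_i-x_i^2)\bigl(1-x_{i-1}+\sum_{j=1}^{i-2}x_j\bigr)$. Define $F_n(\mathbf{x})=\sum_{i=1}^n\bigl(2^{i-1}\alpha_{n,i}(\mathbf{x})-\beta_{n,i}(\mathbf{x})\bigr)$. $\mathbf{e}^n$ is the $n$-th unit vector and $\partial_k$ the partial derivative in the $k$-th coordinate. -}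

module Defs where

open import Data.Nat as ℕ using (ℕ; zero; suc; _∸_)
open import Data.Integer as ℤ using (ℤ; +_; -_)
open import Data.Fin using (Fin; fromℕ<; fromℕ)
open import Data.Fin.Properties using () renaming (_≟_ to _≟ᶠ_)
open import Data.Bool using (Bool; true; false)
open import Relation.Nullary using (yes; no)

-- Formal polynomial expressions with integer coefficients in variables
-- indexed by Fin n (variable j : Fin n stands for x_{j+1}).
data Expr (n : ℕ) : Set where
  con : ℤ → Expr n
  var : Fin n → Expr n
  _⊕_ : Expr n → Expr n → Expr n
  _⊗_ : Expr n → Expr n → Expr n

infixl 6 _⊕_ _⊖_
infixl 7 _⊗_

_⊖_ : ∀ {n} → Expr n → Expr n → Expr n
a ⊖ b = a ⊕ (con (- (+ 1)) ⊗ b)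

eval : ∀ {n} → (Fin n → ℤ) → Expr n → ℤ
eval x (con c) = c
eval x (var j) = x j
eval x (a ⊕ b) = eval x a ℤ.+ eval x b
eval x (a ⊗ b) = eval x a ℤ.* eval x b

-- formal partial derivative w.r.t. variable k (agrees with the analytic
-- partial derivative of the polynomial function)
∂ : ∀ {n} → Fin n → Expr n → Expr n
∂ k (con c) = con (+ 0)
∂ k (var j) with k ≟ᶠ j
... | yes _ = con (+ 1)
... | no _ = con (+ 0)
∂ k (a ⊕ b) = ∂ k a ⊕ ∂ k b
∂ k (a ⊗ b) = (∂ k a ⊗ b) ⊕ (a ⊗ ∂ k b)

-- X n i  is the coordinate x_i (1-based), with x_0 := 1;
-- indices i > n are never used (set to 0).
X : (n : ℕ) → ℕ → Expr n
X n zero = con (+ 1)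
X n (suc i) with i ℕ.<? n
... | yes p = var (fromℕ< p)
... | no _ = con (+ 0)

-- A n m = α_{n, n+1-m}; A n 0 = α_{n,n+1} = 0
A : (n : ℕ) → ℕ → Expr n
A n zero = con (+ 0)
A n (suc m) = X n (n ∸ m) ⊕ ((con (+ 1) ⊖ con (+ 2) ⊗ X n (n ∸ m)) ⊗ A n m)

α : (n : ℕ) → ℕ → Expr n
α n i = A n (suc n ∸ i)

Σ₁ : ∀ {n} → ℕ → (ℕ → Expr n) → Expr n
Σ₁ zero f = con (+ 0)
Σ₁ (suc m) f = Σ₁ m f ⊕ f (suc m)

β : (n : ℕ) → ℕ → Expr n
β n i = con (+ (2 ℕ.^ i)) ⊗ (X n i ⊖ X n i ⊗ X n i)
          ⊗ (con (+ 1) ⊖ X n (i ∸ 1) ⊕ Σ₁ (i ∸ 2) (X n))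

F : (n : ℕ) → Expr n
F n = Σ₁ n (λ i → con (+ (2 ℕ.^ (i ∸ 1))) ⊗ α n i ⊖ β n i)

bit : Bool → ℤ
bit true = + 1
bit false = + 0

-- the n-th (last) unit vector e^n in {0,1}^n, for n = suc m
e : (m : ℕ) → Fin (suc m) → Bool
e m j with j ≟ᶠ fromℕ m
... | yes _ = true
... | no _ = false

{-# OPTIONS --safe #-}
-- At a binary point x − x² vanishes, so ∂ₖ β_i = 0 for i ≠ k, while α_i is the parity
-- x_i ⊕ ⋯ ⊕ x_n and ∂ₖ α_i is (1 − 2x_k)(1 − 2α_i) for i ≤ k and 0 for i > k. Hence
--   (1 − 2x_k) ∂ₖ F_n(x) = Σ_{i ≤ k} 2^{i−1} (1 − 2α_i) − 2^k Z_k,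
-- where Z_k = 1 − x_{k−1} + Σ_{j ≤ k−2} x_j is a natural number. The condition on k says that
-- this is positive; as the last weight 2^{k−1} exceeds the sum of the earlier ones, that
-- happens iff α_k = 0 and Z_k = 0, i.e. k − 1 is 0 or the position p of the first 1 of x.
-- Since α_1 = 1 ⊕ α_{p+1}, exactly one of the two candidates has α_k = 0 (k = 1 if x = 0),
-- and it lies in [n] unless p = n is the only 1, i.e. x = eⁿ.
module Submission where

open import Defs
open import Data.Bool using (Bool; true; false; not; _xor_)
open import Data.Bool.Properties using (not-injective)
open import Data.Empty using (⊥-elim)
open import Data.Fin using (Fin; toℕ; fromℕ<; fromℕ)
open import Data.Fin.Properties using (toℕ<n; toℕ-fromℕ<; fromℕ<-toℕ; toℕ-fromℕ; toℕ-injective) renaming (_≟_ to _≟ᶠ_)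
open import Data.Integer as ℤ using (ℤ; +_; -_; _+_; _-_; _*_; _<_; +<+)
import Data.Integer.Properties as ℤ
import Data.Integer.Tactic.RingSolver as ℤ-Solver
open import Data.List using (_∷_; [])
open import Data.Nat as ℕ using (ℕ; zero; suc; _∸_; _^_)
import Data.Nat.Properties as ℕ
import Data.Nat.Tactic.RingSolver as ℕ-Solver
open import Data.Product using (Σ; ∃; ∃₂; _×_; _,_; proj₁; proj₂)
open import Data.Sum using (_⊎_; inj₁; inj₂)
open import Function.Base using (_∘_)
open import Function.Bundles using (_⇔_; mk⇔; Equivalence)
open import Function.Construct.Composition using (_⇔-∘_)
open import Relation.Binary.Definitions using (tri<; tri≈; tri>)
open import Relation.Binary.PropositionalEquality
open import Relation.Nullary using (¬_; yes; no; contradiction)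

open Equivalence using (to; from)

spin : Bool → ℤ
spin q = + 1 - + 2 * bit q

spin-xor : ∀ p q → spin (p xor q) ≡ spin p * spin q
spin-xor false false = refl
spin-xor false true = refl
spin-xor true false = refl
spin-xor true true = refl

spin*spin : ∀ q → spin q * spin q ≡ + 1
spin*spin false = refl
spin*spin true = refl

sign-condition⇔ : ∀ q D → ((+ 0 < D × q ≡ false) ⊎ (D < + 0 × q ≡ true)) ⇔ + 0 < spin q * D
sign-condition⇔ false D = mk⇔
  (λ { (inj₁ (0<D , _)) → subst (+ 0 <_) (sym (ℤ.*-identityˡ D)) 0<D ; (inj₂ (_ , ())) })
  (λ 0<D → inj₁ (subst (+ 0 <_) (ℤ.*-identityˡ D) 0<D , refl))
sign-condition⇔ true D = mk⇔
  (λ { (inj₁ (_ , ())) ; (inj₂ (D<0 , _)) → subst (+ 0 <_) (sym (ℤ.-1*i≡-i D)) (ℤ.neg-mono-< D<0) })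
  (λ 0<-D → inj₂ (ℤ.neg-cancel-< {+ 0} {D} (subst (+ 0 <_) (ℤ.-1*i≡-i D) 0<-D) , refl))

bitℕ : Bool → ℕ
bitℕ false = 0
bitℕ true = 1

bit≡+bitℕ : ∀ q → bit q ≡ + bitℕ q
bit≡+bitℕ false = refl
bit≡+bitℕ true = refl

signSum : (ℕ → Bool) → ℕ → ℤ
signSum σ zero = + 0
signSum σ (suc j) = signSum σ j + + (2 ^ j) * spin (σ j)

-- An exact form of |signSum σ j| < 2 ^ j.
signSum-split : ∀ σ j → ∃₂ λ p q → suc (p ℕ.+ q) ≡ 2 ^ j × signSum σ j ≡ + p - + q
signSum-split σ zero = 0 , 0 , refl , refl
signSum-split σ (suc j) with signSum-split σ j
... | p , q , c≡ , S≡ rewrite S≡ | sym c≡ = step (σ j)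
  where
  -- At P = + p and Q = + q, the term + 1 + (P + Q) is definitionally + suc (p + q).
  step : ∀ a → ∃₂ λ p′ q′ → suc (p′ ℕ.+ q′) ≡ 2 ℕ.* suc (p ℕ.+ q)
                           × (+ p - + q) + + suc (p ℕ.+ q) * spin a ≡ + p′ - + q′
  step false = p ℕ.+ suc (p ℕ.+ q) , q , ℕ-Solver.solve (p ∷ q ∷ []) , gain (+ p) (+ q)
    where
    gain : ∀ P Q → (P - Q) + (+ 1 + (P + Q)) * + 1 ≡ (P + (+ 1 + (P + Q))) - Q
    gain = ℤ-Solver.solve-∀
  step true = p , q ℕ.+ suc (p ℕ.+ q) , ℕ-Solver.solve (p ∷ q ∷ []) , loss (+ p) (+ q)
    where
    loss : ∀ P Q → (P - Q) + (+ 1 + (P + Q)) * - + 1 ≡ P - (Q + (+ 1 + (P + Q)))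
    loss = ℤ-Solver.solve-∀

-- The last weight 2 ^ j outweighs all the earlier ones together.
signSum-positive⇔ : ∀ σ j z → (+ 0 < signSum σ (suc j) - + (2 ^ suc j) * + z) ⇔ (σ j ≡ false × z ≡ 0)
signSum-positive⇔ σ j z with signSum-split σ j
... | p , q , c≡ , S≡ rewrite S≡ | sym c≡ = criterion (σ j) z
  where
  c = suc (p ℕ.+ q)

  -- After pos-* the term is literally -[1+ _].
  not-positive : ∀ z → ¬ (+ 0 < - (+ 1 + (+ q + + q + + (2 ℕ.* c) * + z)))
  not-positive z rewrite sym (ℤ.pos-* (2 ℕ.* c) z) = λ ()

  criterion : ∀ a z → (+ 0 < ((+ p - + q) + + c * spin a) - + (2 ℕ.* c) * + z) ⇔ (a ≡ false × z ≡ 0)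
  criterion false zero = mk⇔ (λ _ → refl , refl) (λ _ → subst (+ 0 <_) (sym (surplus (+ p) (+ q))) (+<+ ℕ.z<s))
    where
    surplus : ∀ P Q → ((P - Q) + (+ 1 + (P + Q)) * + 1) - (+ 2 * (+ 1 + (P + Q))) * + 0 ≡ + 1 + (P + P)
    surplus = ℤ-Solver.solve-∀
  criterion false (suc z) = mk⇔ (λ v>0 → ⊥-elim (not-positive z (subst (+ 0 <_) (deficit (+ p) (+ q) (+ z)) v>0))) λ ()
    where
    deficit : ∀ P Q Z → ((P - Q) + (+ 1 + (P + Q)) * + 1) - (+ 2 * (+ 1 + (P + Q))) * (+ 1 + Z)
                          ≡ - (+ 1 + (Q + Q + (+ 2 * (+ 1 + (P + Q))) * Z))
    deficit = ℤ-Solver.solve-∀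
  criterion true z = mk⇔ (λ v>0 → ⊥-elim (not-positive z (subst (+ 0 <_) (deficit (+ p) (+ q) (+ z)) v>0))) λ ()
    where
    deficit : ∀ P Q Z → ((P - Q) + (+ 1 + (P + Q)) * - + 1) - (+ 2 * (+ 1 + (P + Q))) * Z
                          ≡ - (+ 1 + (Q + Q + (+ 2 * (+ 1 + (P + Q))) * Z))
    deficit = ℤ-Solver.solve-∀

infixl 6 _⊻_
_⊻_ : ∀ {n} → Expr n → Expr n → Expr n
e ⊻ f = e ⊕ (con (+ 1) ⊖ con (+ 2) ⊗ e) ⊗ f

module _ {n} (ρ : Fin n → ℤ) where

  eval-⊻ : ∀ e f {p q} → eval ρ e ≡ bit p → eval ρ f ≡ bit q → eval ρ (e ⊻ f) ≡ bit (p xor q)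
  eval-⊻ e f {p} {q} e≡ f≡ rewrite e≡ | f≡ = on-bits p q
    where
    on-bits : ∀ p q → bit p + (+ 1 + - + 1 * (+ 2 * bit p)) * bit q ≡ bit (p xor q)
    on-bits false false = refl
    on-bits false true = refl
    on-bits true false = refl
    on-bits true true = refl

  eval-x-x² : ∀ e {q} → eval ρ e ≡ bit q → eval ρ (e ⊖ e ⊗ e) ≡ + 0
  eval-x-x² e {q} e≡ rewrite e≡ = on-bit q
    where
    on-bit : ∀ q → bit q + - + 1 * (bit q * bit q) ≡ + 0
    on-bit false = refl
    on-bit true = refl

  -- The left-hand sides of the identities below are what eval ρ (∂ k …) unfolds to.
  module _ (k : Fin n) where

    ∂-⊻ : ∀ e f → eval ρ (∂ k (e ⊻ f))
                    ≡ eval ρ (∂ k e) * (+ 1 - + 2 * eval ρ f) + (+ 1 - + 2 * eval ρ e) * eval ρ (∂ k f)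
    ∂-⊻ e f = identity (eval ρ e) (eval ρ f) (eval ρ (∂ k e)) (eval ρ (∂ k f))
      where
      identity : ∀ E F dE dF →
        dE + ((+ 0 + (+ 0 * (+ 2 * E) + - + 1 * (+ 0 * E + + 2 * dE))) * F + (+ 1 + - + 1 * (+ 2 * E)) * dF)
          ≡ dE * (+ 1 - + 2 * F) + (+ 1 - + 2 * E) * dF
      identity = ℤ-Solver.solve-∀

    ∂-x-x² : ∀ e → eval ρ (∂ k (e ⊖ e ⊗ e)) ≡ eval ρ (∂ k e) * (+ 1 - + 2 * eval ρ e)
    ∂-x-x² e = identity (eval ρ e) (eval ρ (∂ k e))
      where
      identity : ∀ E dE → dE + (+ 0 * (E * E) + - + 1 * (dE * E + E * dE)) ≡ dE * (+ 1 - + 2 * E)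
      identity = ℤ-Solver.solve-∀

    ∂-scaled-product : ∀ c e f → eval ρ e ≡ + 0 → eval ρ (∂ k (con c ⊗ e ⊗ f)) ≡ c * eval ρ (∂ k e) * eval ρ f
    ∂-scaled-product c e f e≡0 rewrite e≡0 = identity c (eval ρ (∂ k e)) (eval ρ f) (eval ρ (∂ k f))
      where
      identity : ∀ c dE F dF → (+ 0 * + 0 + c * dE) * F + c * + 0 * dF ≡ c * dE * F
      identity = ℤ-Solver.solve-∀

    ∂-scaled-difference : ∀ c e f → eval ρ (∂ k (con c ⊗ e ⊖ f)) ≡ c * eval ρ (∂ k e) - eval ρ (∂ k f)
    ∂-scaled-difference c e f = identity c (eval ρ e) (eval ρ f) (eval ρ (∂ k e)) (eval ρ (∂ k f))
      where
      identity : ∀ c E F dE dF → (+ 0 * E + c * dE) + (+ 0 * F + - + 1 * dF) ≡ c * dE - dF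
      identity = ℤ-Solver.solve-∀

α-top : ∀ n → α n (suc n) ≡ con (+ 0)
α-top n = cong (A n) (ℕ.n∸n≡0 n)

α-suc : ∀ {n i} → i ℕ.≤ n → α n i ≡ X n i ⊻ α n (suc i)
α-suc {n} {i} i≤n = begin
  A n (suc n ∸ i)                              ≡⟨ cong (A n) (ℕ.+-∸-assoc 1 i≤n) ⟩
  X n (n ∸ (n ∸ i)) ⊻ A n (n ∸ i)              ≡⟨ cong (λ j → X n j ⊻ A n (n ∸ i)) (ℕ.m∸[m∸n]≡n i≤n) ⟩
  X n i ⊻ α n (suc i)                          ∎
  where open ≡-Reasoning

∂-X-self : ∀ {n} (k : Fin n) → ∂ k (X n (suc (toℕ k))) ≡ con (+ 1)
∂-X-self {n} k with toℕ k ℕ.<? n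
... | no k≮n = contradiction (toℕ<n k) k≮n
... | yes k<n with k ≟ᶠ fromℕ< k<n
...   | yes _ = refl
...   | no k≢k = contradiction (sym (fromℕ<-toℕ k k<n)) k≢k

∂-X-other : ∀ {n} (k : Fin n) {i} → i ≢ suc (toℕ k) → ∂ k (X n i) ≡ con (+ 0)
∂-X-other k {zero} _ = refl
∂-X-other {n} k {suc i} i≢k with i ℕ.<? n
... | no _ = refl
... | yes i<n with k ≟ᶠ fromℕ< i<n
...   | yes refl = contradiction (cong suc (toℕ-fromℕ< i<n)) (≢-sym i≢k)
...   | no _ = refl

module BitSequence (n : ℕ) (b : ℕ → Bool) where

  ones : ℕ → ℕ
  ones zero = 0
  ones (suc j) = ones j ℕ.+ bitℕ (b (suc j))

  xorRun : ℕ → ℕ → Bool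
  xorRun zero i = false
  xorRun (suc d) i = b i xor xorRun d (suc i)

  parity : ℕ → Bool
  parity i = xorRun (suc n ∸ i) i

  parity-top : parity (suc n) ≡ false
  parity-top = cong (λ d → xorRun d (suc n)) (ℕ.n∸n≡0 n)

  parity-suc : ∀ {i} → i ℕ.≤ n → parity i ≡ b i xor parity (suc i)
  parity-suc {i} i≤n = cong (λ d → xorRun d i) (ℕ.+-∸-assoc 1 i≤n)

  -- gap r is Z_{r+1} = 1 − b r + Σ_{j=1}^{r−1} b j, the last factor of β_{r+1}.
  gap : ℕ → ℕ
  gap r = bitℕ (not (b r)) ℕ.+ ones (r ∸ 1)

  Improving : ℕ → Set
  Improving r = parity (suc r) ≡ false × gap r ≡ 0

  -- suc p is the first positive index i with b i.
  LeadingOne : ℕ → Set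
  LeadingOne p = b (suc p) ≡ true × ones p ≡ 0

  ones-suc≡0 : ∀ {j} → ones (suc j) ≡ 0 → ones j ≡ 0 × b (suc j) ≡ false
  ones-suc≡0 {j} o≡0 = ℕ.m+n≡0⇒m≡0 (ones j) o≡0 , bitℕ≡0 (b (suc j)) (ℕ.m+n≡0⇒n≡0 (ones j) o≡0)
    where
    bitℕ≡0 : ∀ q → bitℕ q ≡ 0 → q ≡ false
    bitℕ≡0 false _ = refl

  ones≡0⇒false : ∀ {i j} → ones j ≡ 0 → i ℕ.< j → b (suc i) ≡ false
  ones≡0⇒false {i} {suc j} o≡0 i<1+j with ℕ.m≤n⇒m<n∨m≡n (ℕ.s≤s⁻¹ i<1+j)
  ... | inj₁ i<j = ones≡0⇒false (proj₁ (ones-suc≡0 o≡0)) i<j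
  ... | inj₂ refl = proj₂ (ones-suc≡0 o≡0)

  ones≡0⇒parity : ∀ {j} → ones j ≡ 0 → j ℕ.≤ n → parity 1 ≡ parity (suc j)
  ones≡0⇒parity {zero} _ _ = refl
  ones≡0⇒parity {suc j} o≡0 j<n with ones-suc≡0 o≡0
  ... | o′≡0 , bj≡false = begin
    parity 1                                    ≡⟨ ones≡0⇒parity o′≡0 (ℕ.<⇒≤ j<n) ⟩
    parity (suc j)                              ≡⟨ parity-suc j<n ⟩
    b (suc j) xor parity (suc (suc j))          ≡⟨ cong (_xor parity (suc (suc j))) bj≡false ⟩
    parity (suc (suc j))                        ∎
    where open ≡-Reasoning

  leading-one? : ∀ j → ones j ≡ 0 ⊎ ∃ λ p → p ℕ.< j × LeadingOne p
  leading-one? zero = inj₁ refl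
  leading-one? (suc j) with leading-one? j | b (suc j) in bj
  ... | inj₂ (p , p<j , lead) | _ = inj₂ (p , ℕ.m≤n⇒m≤1+n p<j , lead)
  ... | inj₁ o≡0 | true = inj₂ (j , ℕ.n<1+n j , bj , o≡0)
  ... | inj₁ o≡0 | false = inj₁ (cong (ℕ._+ 0) o≡0)

  leading-unique : ∀ {p q} → LeadingOne p → LeadingOne q → p ≡ q
  leading-unique {p} {q} (bp , op) (bq , oq) with ℕ.<-cmp p q
  ... | tri< p<q _ _ = contradiction (trans (sym bp) (ones≡0⇒false oq p<q)) λ ()
  ... | tri≈ _ p≡q _ = p≡q
  ... | tri> _ _ q<p = contradiction (trans (sym bq) (ones≡0⇒false op q<p)) λ ()

  gap≡0⇒leading : ∀ {p} → gap (suc p) ≡ 0 → LeadingOne p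
  gap≡0⇒leading {p} g≡0 = flipped (b (suc p)) (ℕ.m+n≡0⇒m≡0 _ g≡0) , ℕ.m+n≡0⇒n≡0 _ g≡0
    where
    flipped : ∀ q → bitℕ (not q) ≡ 0 → q ≡ true
    flipped true _ = refl

  leading⇒gap≡0 : ∀ {p} → LeadingOne p → gap (suc p) ≡ 0
  leading⇒gap≡0 (bp , op) rewrite bp | op = refl

  leading⇒parity : ∀ {p} → suc p ℕ.≤ n → LeadingOne p → parity 1 ≡ not (parity (suc (suc p)))
  leading⇒parity {p} p<n (bp , op) = begin
    parity 1                                    ≡⟨ ones≡0⇒parity op (ℕ.<⇒≤ p<n) ⟩
    parity (suc p)                              ≡⟨ parity-suc p<n ⟩
    b (suc p) xor parity (suc (suc p))          ≡⟨ cong (_xor parity (suc (suc p))) bp ⟩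
    not (parity (suc (suc p)))                  ∎
    where open ≡-Reasoning

  Improving-suc⇔ : ∀ {p} → Improving (suc p) ⇔ (parity (suc (suc p)) ≡ false × LeadingOne p)
  Improving-suc⇔ = mk⇔ (λ (par , g≡0) → par , gap≡0⇒leading g≡0) (λ (par , lead) → par , leading⇒gap≡0 lead)

  Improving-suc⇒parity : ∀ {p} → suc p ℕ.≤ n → Improving (suc p) → parity 1 ≡ true
  Improving-suc⇒parity p<n imp with to Improving-suc⇔ imp
  ... | par , lead = trans (leading⇒parity p<n lead) (cong not par)

  Improving-unique : ∀ {r r′} → r ℕ.≤ n → r′ ℕ.≤ n → Improving r → Improving r′ → r ≡ r′
  Improving-unique {zero} {zero} _ _ _ _ = refl
  Improving-unique {zero} {suc q} _ q<n (par₁ , _) imp = contradiction (trans (sym par₁) (Improving-suc⇒parity q<n imp)) λ ()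
  Improving-unique {suc p} {zero} p<n _ imp (par₁ , _) = contradiction (trans (sym par₁) (Improving-suc⇒parity p<n imp)) λ ()
  Improving-unique {suc p} {suc q} _ _ imp imp′ =
    cong suc (leading-unique (proj₂ (to Improving-suc⇔ imp)) (proj₂ (to Improving-suc⇔ imp′)))

  Improving-exists : 0 ℕ.< n → b 0 ≡ true → ¬ LeadingOne (ℕ.pred n) → ∃ λ r → r ℕ.< n × Improving r
  Improving-exists 0<n b₀ not-eⁿ with parity 1 in par₁
  ... | false = 0 , 0<n , par₁ , cong (λ q → bitℕ (not q) ℕ.+ 0) b₀
  ... | true with leading-one? n
  ...   | inj₁ o≡0 = contradiction (trans (sym par₁) (trans (ones≡0⇒parity o≡0 ℕ.≤-refl) parity-top)) λ ()
  ...   | inj₂ (p , p<n , lead) with ℕ.m≤n⇒m<n∨m≡n p<n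
  ...     | inj₂ 1+p≡n = contradiction (subst LeadingOne (cong ℕ.pred 1+p≡n) lead) not-eⁿ
  ...     | inj₁ 1+p<n = suc p , 1+p<n , from Improving-suc⇔ (not-injective (trans (sym (leading⇒parity p<n lead)) par₁) , lead)

module AtBinaryPoint {n : ℕ} (x : Fin n → Bool) where

  ρ : Fin n → ℤ
  ρ j = bit (x j)

  bits : ℕ → Bool
  bits zero = true
  bits (suc i) with i ℕ.<? n
  ... | yes i<n = x (fromℕ< i<n)
  ... | no _ = false

  eval-X : ∀ i → eval ρ (X n i) ≡ bit (bits i)
  eval-X zero = refl
  eval-X (suc i) with i ℕ.<? n
  ... | yes _ = refl
  ... | no _ = refl

  bits-toℕ : ∀ j → bits (suc (toℕ j)) ≡ x j
  bits-toℕ j with toℕ j ℕ.<? n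
  ... | yes j<n = cong x (fromℕ<-toℕ j j<n)
  ... | no j≮n = contradiction (toℕ<n j) j≮n

  open BitSequence n bits public

  eval-ones : ∀ j → eval ρ (Σ₁ j (X n)) ≡ + ones j
  eval-ones zero = refl
  eval-ones (suc j) = cong₂ _+_ (eval-ones j) (trans (eval-X (suc j)) (bit≡+bitℕ (bits (suc j))))

  Z : ℕ → Expr n
  Z i = con (+ 1) ⊖ X n (i ∸ 1) ⊕ Σ₁ (i ∸ 2) (X n)

  eval-gap : ∀ r → eval ρ (Z (suc r)) ≡ + gap r
  eval-gap r rewrite eval-X r | eval-ones (r ∸ 1) = on-bit (bits r) (ones (r ∸ 1))
    where
    on-bit : ∀ q o → (+ 1 + - + 1 * bit q) + + o ≡ + (bitℕ (not q) ℕ.+ o)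
    on-bit false o = refl
    on-bit true o = refl

  eval-α : ∀ {i} → i ℕ.≤‴ suc n → eval ρ (α n i) ≡ bit (parity i)
  eval-α ℕ.≤‴-refl = trans (cong (eval ρ) (α-top n)) (cong bit (sym parity-top))
  eval-α {i} (ℕ.≤‴-step i<n) = begin
    eval ρ (α n i)                          ≡⟨ cong (eval ρ) (α-suc i≤n) ⟩
    eval ρ (X n i ⊻ α n (suc i))            ≡⟨ eval-⊻ ρ (X n i) (α n (suc i)) (eval-X i) (eval-α i<n) ⟩
    bit (bits i xor parity (suc i))         ≡⟨ cong bit (sym (parity-suc i≤n)) ⟩
    bit (parity i)                          ∎
    where
    open ≡-Reasoning
    i≤n = ℕ.s≤s⁻¹ (ℕ.≤‴⇒≤ i<n)

  module Partial (k : Fin n) where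

    K : ℕ
    K = suc (toℕ k)

    s : ℤ
    s = spin (bits K)

    D : Expr n → ℤ
    D e = eval ρ (∂ k e)

    ∂α-suc : ∀ {i} → i ℕ.≤ n → D (α n i) ≡ D (X n i) * spin (parity (suc i)) + spin (bits i) * D (α n (suc i))
    ∂α-suc {i} i≤n = begin
      D (α n i)                               ≡⟨ cong D (α-suc i≤n) ⟩
      D (X n i ⊻ α n (suc i))                 ≡⟨ ∂-⊻ ρ k (X n i) (α n (suc i)) ⟩
      D (X n i) * (+ 1 - + 2 * eval ρ (α n (suc i))) + (+ 1 - + 2 * eval ρ (X n i)) * D (α n (suc i))
        ≡⟨ cong₂ (λ a c → D (X n i) * (+ 1 - + 2 * a) + (+ 1 - + 2 * c) * D (α n (suc i)))
                 (eval-α (ℕ.≤⇒≤‴ (ℕ.s≤s i≤n))) (eval-X i) ⟩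
      D (X n i) * spin (parity (suc i)) + spin (bits i) * D (α n (suc i))  ∎
      where open ≡-Reasoning

    ∂α-above : ∀ {i} → i ℕ.≤‴ suc n → K ℕ.< i → D (α n i) ≡ + 0
    ∂α-above ℕ.≤‴-refl _ = cong D (α-top n)
    ∂α-above {i} (ℕ.≤‴-step i<n) K<i = begin
      D (α n i)                                                        ≡⟨ ∂α-suc (ℕ.s≤s⁻¹ (ℕ.≤‴⇒≤ i<n)) ⟩
      D (X n i) * spin (parity (suc i)) + spin (bits i) * D (α n (suc i))
        ≡⟨ cong₂ (λ d d′ → d * spin (parity (suc i)) + spin (bits i) * d′)
                 (cong (eval ρ) (∂-X-other k (ℕ.>⇒≢ K<i))) (∂α-above i<n (ℕ.m<n⇒m<1+n K<i)) ⟩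
      + 0 * spin (parity (suc i)) + spin (bits i) * + 0                ≡⟨ vanish (spin (parity (suc i))) (spin (bits i)) ⟩
      + 0                                                              ∎
      where
      open ≡-Reasoning
      vanish : ∀ a c → + 0 * a + c * + 0 ≡ + 0
      vanish = ℤ-Solver.solve-∀

    K≤n : K ℕ.≤ n
    K≤n = toℕ<n k

    ∂α-below : ∀ {i} → i ℕ.≤‴ K → s * D (α n i) ≡ spin (parity i)
    ∂α-below ℕ.≤‴-refl = begin
      s * D (α n K)                                                     ≡⟨ cong (s *_) (∂α-suc K≤n) ⟩
      s * (D (X n K) * spin (parity (suc K)) + s * D (α n (suc K)))
        ≡⟨ cong₂ (λ d d′ → s * (d * spin (parity (suc K)) + s * d′))
                 (cong (eval ρ) (∂-X-self k)) (∂α-above (ℕ.≤⇒≤‴ (ℕ.s≤s K≤n)) ℕ.≤-refl) ⟩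
      s * (+ 1 * spin (parity (suc K)) + s * + 0)                       ≡⟨ simplify s (spin (parity (suc K))) ⟩
      s * spin (parity (suc K))                                         ≡⟨ sym (spin-xor (bits K) (parity (suc K))) ⟩
      spin (bits K xor parity (suc K))                                  ≡⟨ cong spin (sym (parity-suc K≤n)) ⟩
      spin (parity K)                                                   ∎
      where
      open ≡-Reasoning
      simplify : ∀ s a → s * (+ 1 * a + s * + 0) ≡ s * a
      simplify = ℤ-Solver.solve-∀
    ∂α-below {i} (ℕ.≤‴-step i<K) = begin
      s * D (α n i)                                                     ≡⟨ cong (s *_) (∂α-suc i≤n) ⟩
      s * (D (X n i) * spin (parity (suc i)) + spin (bits i) * D (α n (suc i)))
        ≡⟨ cong (λ d → s * (d * spin (parity (suc i)) + spin (bits i) * D (α n (suc i))))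
                (cong (eval ρ) (∂-X-other k (ℕ.<⇒≢ (ℕ.≤‴⇒≤ i<K)))) ⟩
      s * (+ 0 * spin (parity (suc i)) + spin (bits i) * D (α n (suc i)))
        ≡⟨ simplify s (spin (parity (suc i))) (spin (bits i)) (D (α n (suc i))) ⟩
      spin (bits i) * (s * D (α n (suc i)))                             ≡⟨ cong (spin (bits i) *_) (∂α-below i<K) ⟩
      spin (bits i) * spin (parity (suc i))                             ≡⟨ sym (spin-xor (bits i) (parity (suc i))) ⟩
      spin (bits i xor parity (suc i))                                  ≡⟨ cong spin (sym (parity-suc i≤n)) ⟩
      spin (parity i)                                                   ∎
      where
      open ≡-Reasoning
      i≤n = ℕ.≤-trans (ℕ.<⇒≤ (ℕ.≤‴⇒≤ i<K)) K≤n
      simplify : ∀ s a c d → s * (+ 0 * a + c * d) ≡ c * (s * d)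
      simplify = ℤ-Solver.solve-∀

    ∂β : ∀ i → D (β n i) ≡ + (2 ^ i) * (D (X n i) * spin (bits i)) * eval ρ (Z i)
    ∂β i = trans (∂-scaled-product ρ k (+ (2 ^ i)) (X n i ⊖ X n i ⊗ X n i) (Z i) (eval-x-x² ρ (X n i) (eval-X i)))
                 (cong (λ d → + (2 ^ i) * d * _)
                       (trans (∂-x-x² ρ k (X n i)) (cong (λ v → D (X n i) * (+ 1 - + 2 * v)) (eval-X i))))

    ∂β-other : ∀ {i} → i ≢ K → D (β n i) ≡ + 0
    ∂β-other {i} i≢K rewrite ∂β i | ∂-X-other k i≢K = vanish (+ (2 ^ i)) (spin (bits i)) _
      where
      vanish : ∀ c a z → c * (+ 0 * a) * z ≡ + 0
      vanish = ℤ-Solver.solve-∀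

    ∂β-self : D (β n K) ≡ + (2 ^ K) * s * + gap (toℕ k)
    ∂β-self rewrite ∂β K | ∂-X-self k | eval-gap (toℕ k) = simplify (+ (2 ^ K)) s (+ gap (toℕ k))
      where
      simplify : ∀ c a z → c * (+ 1 * a) * z ≡ c * a * z
      simplify = ℤ-Solver.solve-∀

    summand : ℕ → Expr n
    summand i = con (+ (2 ^ (i ∸ 1))) ⊗ α n i ⊖ β n i

    summand-below : ∀ {j} → suc j ℕ.< K → s * D (summand (suc j)) ≡ + (2 ^ j) * spin (parity (suc j))
    summand-below {j} 1+j<K = begin
      s * D (summand (suc j))                     ≡⟨ cong (s *_) (∂-scaled-difference ρ k (+ (2 ^ j)) (α n (suc j)) (β n (suc j))) ⟩
      s * (+ (2 ^ j) * D (α n (suc j)) - D (β n (suc j)))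
                                                  ≡⟨ cong (λ d → s * (+ (2 ^ j) * D (α n (suc j)) - d)) (∂β-other (ℕ.<⇒≢ 1+j<K)) ⟩
      s * (+ (2 ^ j) * D (α n (suc j)) - + 0)     ≡⟨ simplify s (+ (2 ^ j)) (D (α n (suc j))) ⟩
      + (2 ^ j) * (s * D (α n (suc j)))           ≡⟨ cong (+ (2 ^ j) *_) (∂α-below (ℕ.≤⇒≤‴ (ℕ.<⇒≤ 1+j<K))) ⟩
      + (2 ^ j) * spin (parity (suc j))           ∎
      where
      open ≡-Reasoning
      simplify : ∀ s c d → s * (c * d - + 0) ≡ c * (s * d)
      simplify = ℤ-Solver.solve-∀

    summand-self : s * D (summand K) ≡ + (2 ^ toℕ k) * spin (parity K) - + (2 ^ K) * + gap (toℕ k)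
    summand-self = begin
      s * D (summand K)                           ≡⟨ cong (s *_) (∂-scaled-difference ρ k c (α n K) (β n K)) ⟩
      s * (c * D (α n K) - D (β n K))             ≡⟨ cong (λ d → s * (c * D (α n K) - d)) ∂β-self ⟩
      s * (c * D (α n K) - c′ * s * g)            ≡⟨ expand s c c′ (D (α n K)) g ⟩
      c * (s * D (α n K)) - c′ * (s * s) * g      ≡⟨ cong₂ (λ a t → c * a - c′ * t * g) (∂α-below ℕ.≤‴-refl) (spin*spin (bits K)) ⟩
      c * spin (parity K) - c′ * + 1 * g          ≡⟨ cong (λ t → c * spin (parity K) - t * g) (ℤ.*-identityʳ c′) ⟩
      c * spin (parity K) - c′ * g                ∎
      where
      open ≡-Reasoning
      c = + (2 ^ toℕ k)
      c′ = + (2 ^ K)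
      g = + gap (toℕ k)
      expand : ∀ s c c′ d g → s * (c * d - c′ * s * g) ≡ c * (s * d) - c′ * (s * s) * g
      expand = ℤ-Solver.solve-∀

    summand-above : ∀ {i} → K ℕ.< i → i ℕ.≤ n → D (summand i) ≡ + 0
    summand-above {i} K<i i≤n = begin
      D (summand i)                                ≡⟨ ∂-scaled-difference ρ k c (α n i) (β n i) ⟩
      c * D (α n i) - D (β n i)
        ≡⟨ cong₂ (λ a d → c * a - d) (∂α-above (ℕ.≤⇒≤‴ (ℕ.m≤n⇒m≤1+n i≤n)) K<i) (∂β-other (ℕ.>⇒≢ K<i)) ⟩
      c * + 0 - + 0                                ≡⟨ cong (_- + 0) (ℤ.*-zeroʳ c) ⟩
      + 0                                          ∎
      where
      open ≡-Reasoning
      c = + (2 ^ (i ∸ 1))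

    σ : ℕ → Bool
    σ i = parity (suc i)

    ∂F-prefix : ∀ {j} → j ℕ.≤ toℕ k → s * D (Σ₁ j summand) ≡ signSum σ j
    ∂F-prefix {zero} _ = ℤ.*-zeroʳ s
    ∂F-prefix {suc j} j<r = trans (ℤ.*-distribˡ-+ s (D (Σ₁ j summand)) (D (summand (suc j))))
                                  (cong₂ _+_ (∂F-prefix (ℕ.<⇒≤ j<r)) (summand-below (ℕ.s≤s j<r)))

    ∂F-tail : ∀ {j} → K ℕ.≤ j → j ℕ.≤ n → D (Σ₁ j summand) ≡ D (Σ₁ K summand)
    ∂F-tail {suc j} K≤1+j j<n with ℕ.m≤n⇒m<n∨m≡n K≤1+j
    ... | inj₂ refl = refl
    ... | inj₁ K<1+j = trans (cong₂ _+_ (∂F-tail (ℕ.s≤s⁻¹ K<1+j) (ℕ.<⇒≤ j<n)) (summand-above K<1+j j<n))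
                             (ℤ.+-identityʳ (D (Σ₁ K summand)))

    spin·∂F : s * D (F n) ≡ signSum σ K - + (2 ^ K) * + gap (toℕ k)
    spin·∂F = begin
      s * D (F n)                                               ≡⟨ cong (s *_) (∂F-tail K≤n ℕ.≤-refl) ⟩
      s * D (Σ₁ K summand)                                      ≡⟨ ℤ.*-distribˡ-+ s (D (Σ₁ (toℕ k) summand)) (D (summand K)) ⟩
      s * D (Σ₁ (toℕ k) summand) + s * D (summand K)            ≡⟨ cong₂ _+_ (∂F-prefix ℕ.≤-refl) summand-self ⟩
      signSum σ (toℕ k) + (lastTerm - c′ * g)                   ≡⟨ sym (ℤ.+-assoc (signSum σ (toℕ k)) lastTerm (- (c′ * g))) ⟩
      signSum σ K - c′ * g                                      ∎
      where
      open ≡-Reasoning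
      c′ = + (2 ^ K)
      g = + gap (toℕ k)
      lastTerm = + (2 ^ toℕ k) * spin (σ (toℕ k))

    condition⇔Improving : ((+ 0 < D (F n) × x k ≡ false) ⊎ (D (F n) < + 0 × x k ≡ true)) ⇔ Improving (toℕ k)
    condition⇔Improving =
      subst (λ v → (+ 0 < v) ⇔ Improving (toℕ k)) value≡ (signSum-positive⇔ σ (toℕ k) (gap (toℕ k)))
        ⇔-∘ sign-condition⇔ (x k) (D (F n))
      where
      value≡ : signSum σ K - + (2 ^ K) * + gap (toℕ k) ≡ spin (x k) * D (F n)
      value≡ = trans (sym spin·∂F) (cong (λ q → spin q * D (F n)) (bits-toℕ k))

module _ {m : ℕ} (x : Fin (suc m) → Bool) where
  open AtBinaryPoint x

  leading-at-top⇒eⁿ : LeadingOne m → ∀ j → x j ≡ e m j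
  leading-at-top⇒eⁿ (bm , om) j with j ≟ᶠ fromℕ m
  ... | yes refl = trans (sym (bits-toℕ (fromℕ m))) (trans (cong (λ i → bits (suc i)) (toℕ-fromℕ m)) bm)
  ... | no j≢top = trans (sym (bits-toℕ j)) (ones≡0⇒false om (ℕ.≤∧≢⇒< (ℕ.s≤s⁻¹ (toℕ<n j)) j≢m))
    where
    j≢m : toℕ j ≢ m
    j≢m eq = j≢top (toℕ-injective (trans eq (sym (toℕ-fromℕ m))))

proposition2 : (m : ℕ) → (x : Fin (suc m) → Bool) →
  ¬ (∀ j → x j ≡ e m j) →
  Σ (Fin (suc m)) (λ k →
    (((+ 0 < eval (λ j → bit (x j)) (∂ k (F (suc m)))) × x k ≡ false)
      ⊎ ((eval (λ j → bit (x j)) (∂ k (F (suc m))) < + 0) × x k ≡ true))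
    × (∀ k′ →
      (((+ 0 < eval (λ j → bit (x j)) (∂ k′ (F (suc m)))) × x k′ ≡ false)
        ⊎ ((eval (λ j → bit (x j)) (∂ k′ (F (suc m))) < + 0) × x k′ ≡ true))
      → k′ ≡ k))
proposition2 m x x≢eⁿ =
  let open AtBinaryPoint x
      (r , r<n , improving) = Improving-exists ℕ.z<s refl (x≢eⁿ ∘ leading-at-top⇒eⁿ x)
      k = fromℕ< r<n
      improving-k = subst Improving (sym (toℕ-fromℕ< r<n)) improving
  in k
   , from (Partial.condition⇔Improving k) improving-k
   , λ k′ cond → toℕ-injective (Improving-unique (ℕ.<⇒≤ (toℕ<n k′)) (ℕ.<⇒≤ (toℕ<n k))
                                                 (to (Partial.condition⇔Improving k′) cond) improving-k)
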